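{- Let $G=(V_1\cup V_2,E)$ be an embedded bipartite multigraph (multiple edges allowed) of genus $g$ with bipartition classes $V_1,V_2$, such that $|V_1|=1$ and every vertex of $V_2$ has degree at least $2$. Let $k\ge 2$ be an integer and let $i$ be the number of faces of size less than $2k$. Then $$ i\ge \frac{k}{k-1}-\frac{2k}{k-1}g+\frac{k-2}{k-1}|V_2|. $$ If moreover $k\ge 3$ and there is at most one face of size $2$, then $$ i\ge \frac{k-1}{k-2}-\frac{2k}{k-2}g+|V_2|. $$
   Context: An embedded graph is a connected (multi)graph with a combinatorial embedding in an orientable surface: each edge gives two directed edges, each vertex has a cyclic rotational order of its outgoing directed edges, and faces are the cyclic sequences of pairwise different directed edges $(v_0,v_1),\dots,(v_{k-1},v_0)$ with $(v_{i+1},v_{i+2})$ following $(v_{i+1},v_i)$ at $v_{i+1}$; the size of a face is its number of directed edges. The genus $g$ satisfies $v-e+f=2-2g$. -}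

module Defs where

open import Data.Nat using (ℕ; zero; suc; _+_; _*_; _≤_; _<_; _≤?_)
open import Data.Fin using (Fin; toℕ)
open import Data.Fin.Properties using (all?; any?; _≟_)
open import Data.Bool using (Bool; true; false)
open import Data.List using (List; filter; length; allFin)
open import Data.Product using (Σ; ∃; _×_; _,_)
open import Relation.Nullary using (¬_; Dec)
open import Relation.Unary using (Pred; Decidable)
open import Relation.Binary.PropositionalEquality using (_≡_; _≢_)
open import Data.Bool.Properties using () renaming (_≟_ to _≟B_)
open import Data.Unit using (⊤; tt)
open import Relation.Nullary using (yes; _×-dec_)
import Data.Nat as N

iter : {A : Set} → (A → A) → ℕ → A → A
iter f zero    x = x
iter f (suc j) x = f (iter f j x)

count : {n : ℕ} {P : Pred (Fin n) Agda.Primitive.lzero} → Decidable P → ℕ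
count {n} P? = length (filter P? (allFin n))

-- d' lies in the f-orbit of d (for a permutation of Fin n, n iterations suffice)
InOrbit : {n : ℕ} → (Fin n → Fin n) → Fin n → Fin n → Set
InOrbit {n} f d d' = ∃ λ (j : Fin n) → iter f (toℕ j) d ≡ d'

inOrbit? : {n : ℕ} (f : Fin n → Fin n) (d : Fin n) → Decidable (InOrbit f d)
inOrbit? f d d' = any? (λ j → iter f (toℕ j) d ≟ d')

orbitSize : {n : ℕ} → (Fin n → Fin n) → Fin n → ℕ
orbitSize f d = count (inOrbit? f d)

IsRep : {n : ℕ} → (Fin n → Fin n) → Fin n → Set
IsRep {n} f d = (j : Fin n) → toℕ d ≤ toℕ (iter f (toℕ j) d)

isRep? : {n : ℕ} (f : Fin n → Fin n) → Decidable (IsRep f)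
isRep? f d = all? (λ j → toℕ d ≤? toℕ (iter f (toℕ j) d))

countOrbits : {n : ℕ} (f : Fin n → Fin n) {P : Pred (Fin n) Agda.Primitive.lzero} → Decidable P → ℕ
countOrbits f P? = count (λ d → isRep? f d ×-dec P? d)

data Reach {n : ℕ} (σ α : Fin n → Fin n) (d : Fin n) : Fin n → Set where
  here  : Reach σ α d d
  stepσ : ∀ {d'} → Reach σ α d d' → Reach σ α d (σ d')
  stepα : ∀ {d'} → Reach σ α d d' → Reach σ α d (α d')

-- A connected embedded (multi)graph with m edges, given combinatorially:
-- darts (directed edges) are Fin (2 * m); α sends a directed edge to its reverse;
-- σ sends a directed edge (v,w) to the next outgoing directed edge at v in the rotation.
-- Vertices are σ-cycles, edges are α-orbits, faces are cycles of φ = σ ∘ α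
-- (the face successor of (u,v) is the directed edge following (v,u) at v).
record EmbeddedGraph (m : ℕ) : Set where
  field
    α      : Fin (2 * m) → Fin (2 * m)
    α-invol : ∀ d → α (α d) ≡ d
    α-fpf  : ∀ d → α d ≢ d
    σ      : Fin (2 * m) → Fin (2 * m)
    σ⁻¹    : Fin (2 * m) → Fin (2 * m)
    σσ⁻¹   : ∀ d → σ (σ⁻¹ d) ≡ d
    σ⁻¹σ   : ∀ d → σ⁻¹ (σ d) ≡ d
    connected : ∀ d d' → Reach σ α d d'

  φ : Fin (2 * m) → Fin (2 * m)
  φ d = σ (α d)

  trivial? : Decidable {A = Fin (2 * m)} (λ _ → ⊤)
  trivial? _ = yes tt

  numVertices : ℕ
  numVertices = countOrbits σ trivial?

  numEdges : ℕ
  numEdges = m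

  numFaces : ℕ
  numFaces = countOrbits φ trivial?

  HasGenus : ℕ → Set
  HasGenus g = numVertices + numFaces + 2 * g ≡ 2 + numEdges

  degree : Fin (2 * m) → ℕ
  degree d = orbitSize σ d

  facesSmallerThan : ℕ → ℕ
  facesSmallerThan s = countOrbits φ (λ d → suc (orbitSize φ d) ≤? s)

  facesOfSize : ℕ → ℕ
  facesOfSize s = countOrbits φ (λ d → orbitSize φ d N.≟ s)

-- A bipartition (V₁,V₂) of the vertex set, given as a colouring of darts by the
-- class of their tail vertex (true = V₁, false = V₂).
record Bipartition {m : ℕ} (G : EmbeddedGraph m) : Set where
  open EmbeddedGraph G
  field
    col      : Fin (2 * m) → Bool
    col-vert : ∀ d → col (σ d) ≡ col d
    col-edge : ∀ d → col (α d) ≢ col d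

  sizeV₁ : ℕ
  sizeV₁ = countOrbits σ (λ d → col d ≟B true)

  sizeV₂ : ℕ
  sizeV₂ = countOrbits σ (λ d → col d ≟B false)

-- Faces are the orbits of φ = σ ∘ α on the 2m darts, so their sizes add up to 2m. The colouring
-- alternates along φ, hence every face has size at least 2, and at least 4 unless it is a digon.
-- Charging 2k to every face, a face of size ≥ 2k pays for itself and a smaller one is short by at
-- most 2k − 2 (by 2k − 4 if it is not a digon), so 2k·f ≤ 2m + (2k − 2)·i, resp.
-- 2k·f ≤ 2m + (2k − 4)·i + 2. On the vertex side α maps the darts at V₂ injectively to the darts
-- at V₁, and V₂-vertices have degree ≥ 2, so 2|V₂| ≤ m. Substituting v = 1 + |V₂| into Euler's
-- formula turns these into the two bounds.

module Submission where

open import Defs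
open import Data.Nat using (ℕ; zero; suc; _+_; _*_; _∸_; _≤_; _<_; z≤n; s≤s; _≤?_; NonZero; >-nonZero)
import Data.Nat as ℕ
open import Data.Nat.Properties
  using (+-*-semiring; +-identityʳ; *-identityʳ; *-identityˡ; *-zeroʳ; *-assoc; *-distribˡ-+;
         ≤-reflexive; ≤-antisym; ≤-trans; ≤-<-trans; ≤-pred; <⇒≤; ≰⇒>; <-cmp; n<1+n; m≤m+n;
         +-mono-≤; +-monoˡ-≤; +-monoʳ-≤; *-monoʳ-≤; +-cancelˡ-≤; *-cancelˡ-≤;
         m∸n≤m; m<n⇒0<n∸m; m+[n∸m]≡n; m∸n+n≡m; module ≤-Reasoning)
open import Data.Nat.DivMod using (_%_; _/_; m%n<n; m≡m%n+[m/n]*n)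
open import Data.Nat.Tactic.RingSolver using (solve-∀)
open import Algebra.Properties.Semiring.Sum +-*-semiring
  using (sum; sum-syntax; ∑-comm; ∑-distrib-+; *-distribˡ-sum; sum-cong-≗; sum-remove; sum-replicate-zero)
open import Data.Bool using (Bool; true; false; not; if_then_else_)
open import Data.Bool.Properties using (¬-not; not-involutive) renaming (_≟_ to _≟ᴮ_)
open import Data.Fin using (Fin; zero; suc; toℕ; fromℕ<)
open import Data.Fin.Properties using (_≟_; 0≢1+n; suc-injective; pigeonhole; toℕ-injective; toℕ<n; toℕ-fromℕ<)
open import Data.List using (length; filter; tabulate; allFin)
open import Data.List.Properties using (filter-all; length-tabulate)
import Data.List.Relation.Unary.All as All
open import Data.Product using (∃; _×_; _,_; proj₁)
open import Data.Unit using (⊤; tt)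
open import Data.Vec.Functional using (removeAt)
open import Function using (_∘_; id)
open import Function.Definitions using (Injective)
open import Level using (0ℓ)
open import Relation.Binary using (tri<; tri≈; tri>)
open import Relation.Nullary using (Dec; yes; no; does; _×-dec_; contradiction)
open import Relation.Unary using (Pred; Decidable)
open import Relation.Binary.PropositionalEquality
  using (_≡_; _≢_; refl; sym; trans; cong; cong₂; subst; subst₂; module ≡-Reasoning)

𝟙 : ∀ {p} {P : Set p} → Dec P → ℕ
𝟙 P? = if does P? then 1 else 0

𝟙-×-dec : ∀ {p q} {P : Set p} {Q : Set q} (P? : Dec P) (Q? : Dec Q) → 𝟙 (P? ×-dec Q?) ≡ 𝟙 P? * 𝟙 Q?
𝟙-×-dec (yes _) Q? = sym (+-identityʳ (𝟙 Q?))
𝟙-×-dec (no _)  Q? = refl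

*-𝟙-≤ : ∀ {p} {P : Set p} (P? : Dec P) {c s} → (P → c ≤ s) → c * 𝟙 P? ≤ 𝟙 P? * s
*-𝟙-≤ (yes p) {c} {s} c≤s = subst₂ _≤_ (sym (*-identityʳ c)) (sym (*-identityˡ s)) (c≤s p)
*-𝟙-≤ (no _)  {c}     _   = ≤-reflexive (*-zeroʳ c)

∑-mono-≤ : ∀ {n} {f g : Fin n → ℕ} → (∀ i → f i ≤ g i) → ∑[ i < n ] f i ≤ ∑[ i < n ] g i
∑-mono-≤ {zero}  f≤g = z≤n
∑-mono-≤ {suc n} f≤g = +-mono-≤ (f≤g zero) (∑-mono-≤ (f≤g ∘ suc))

length-filter-tabulate : ∀ {a} {A : Set a} {n} {P : Pred A 0ℓ} (P? : Decidable P) (f : Fin n → A)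
                         → length (filter P? (tabulate f)) ≡ ∑[ i < n ] 𝟙 (P? (f i))
length-filter-tabulate {n = zero}  P? f = refl
length-filter-tabulate {n = suc n} P? f with does (P? (f zero))
... | true  = cong suc (length-filter-tabulate P? (f ∘ suc))
... | false = length-filter-tabulate P? (f ∘ suc)

count≡∑𝟙 : ∀ {n} {P : Pred (Fin n) 0ℓ} (P? : Decidable P) → count P? ≡ ∑[ i < n ] 𝟙 (P? i)
count≡∑𝟙 P? = length-filter-tabulate P? id

count-all : ∀ n → count {n} (λ _ → yes tt) ≡ n
count-all n = trans (cong length (filter-all (λ _ → yes tt) (All.universal _ (allFin n)))) (length-tabulate id)

∑𝟙-≤-𝟙 : ∀ {n} {P : Pred (Fin n) 0ℓ} (P? : Decidable P) {q} {Q : Set q} (Q? : Dec Q)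
         → (∀ {i j} → P i → P j → i ≡ j) → (∀ {i} → P i → Q)
         → ∑[ i < n ] 𝟙 (P? i) ≤ 𝟙 Q?
∑𝟙-≤-𝟙 {zero}  P? Q? unique P⇒Q = z≤n
∑𝟙-≤-𝟙 {suc n} P? Q? unique P⇒Q with P? zero
... | no _  = ∑𝟙-≤-𝟙 (P? ∘ suc) Q? (λ p p′ → suc-injective (unique p p′)) P⇒Q
... | yes p with Q?
...   | no ¬q = contradiction (P⇒Q p) ¬q
...   | yes _ = s≤s (∑𝟙-≤-𝟙 (P? ∘ suc) (no id) (λ p′ p″ → suc-injective (unique p′ p″))
                                              (λ p′ → 0≢1+n (unique p p′)))

𝟙-≤-∑𝟙 : ∀ {n} {P : Pred (Fin n) 0ℓ} (P? : Decidable P) {q} {Q : Set q} (Q? : Dec Q)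
         → (Q → ∃ P) → 𝟙 Q? ≤ ∑[ i < n ] 𝟙 (P? i)
𝟙-≤-∑𝟙 P? (no _) Q⇒∃P = z≤n
𝟙-≤-∑𝟙 {zero}  P? (yes q) Q⇒∃P with () ← proj₁ (Q⇒∃P q)
𝟙-≤-∑𝟙 {suc n} P? (yes q) Q⇒∃P with Q⇒∃P q
... | i , p = begin
  1                                               ≡⟨ sym (𝟙-yes (P? i) p) ⟩
  𝟙 (P? i)                                        ≤⟨ m≤m+n _ _ ⟩
  𝟙 (P? i) + sum (removeAt (λ j → 𝟙 (P? j)) i)    ≡⟨ sym (sum-remove (λ j → 𝟙 (P? j))) ⟩
  ∑[ j < suc n ] 𝟙 (P? j)                         ∎
  where
  open ≤-Reasoning
  𝟙-yes : ∀ {p} {P : Set p} (P? : Dec P) → P → 𝟙 P? ≡ 1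
  𝟙-yes (yes _) _ = refl
  𝟙-yes (no ¬p) p = contradiction p ¬p

∑𝟙-×-dec : ∀ {n} {p} {P : Set p} (P? : Dec P) {Q : Pred (Fin n) 0ℓ} (Q? : Decidable Q)
           → ∑[ i < n ] 𝟙 (P? ×-dec Q? i) ≡ 𝟙 P? * count Q?
∑𝟙-×-dec {n} P? Q? = begin
  ∑[ i < n ] 𝟙 (P? ×-dec Q? i)     ≡⟨ sum-cong-≗ (λ i → 𝟙-×-dec P? (Q? i)) ⟩
  ∑[ i < n ] (𝟙 P? * 𝟙 (Q? i))     ≡⟨ sym (*-distribˡ-sum (𝟙 P?) (λ i → 𝟙 (Q? i))) ⟩
  𝟙 P? * ∑[ i < n ] 𝟙 (Q? i)       ≡⟨ cong (𝟙 P? *_) (sym (count≡∑𝟙 Q?)) ⟩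
  𝟙 P? * count Q?                  ∎
  where open ≡-Reasoning

count-≟ : ∀ {n} (i : Fin n) → count (i ≟_) ≡ 1
count-≟ i = trans (count≡∑𝟙 (i ≟_))
  (≤-antisym (∑𝟙-≤-𝟙 (i ≟_) (yes tt) (λ i≡j i≡j′ → trans (sym i≡j) i≡j′) _)
             (𝟙-≤-∑𝟙 (i ≟_) (yes tt) (λ _ → i , refl)))

∑𝟙-graph : ∀ {n} {p} {P : Set p} (P? : Dec P) (i : Fin n) → ∑[ j < n ] 𝟙 (P? ×-dec (i ≟ j)) ≡ 𝟙 P?
∑𝟙-graph P? i = trans (∑𝟙-×-dec P? (i ≟_)) (trans (cong (𝟙 P? *_) (count-≟ i)) (*-identityʳ (𝟙 P?)))

module _ {m n : ℕ} {R : Fin m → Fin n → Set} (R? : ∀ i j → Dec (R i j)) where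

  ∑∑𝟙-≤-count : {Q : Pred (Fin n) 0ℓ} (Q? : Decidable Q)
                → (∀ {i i′ j} → R i j → R i′ j → i ≡ i′) → (∀ {i j} → R i j → Q j)
                → ∑[ i < m ] ∑[ j < n ] 𝟙 (R? i j) ≤ count Q?
  ∑∑𝟙-≤-count Q? unique R⇒Q = begin
    ∑[ i < m ] ∑[ j < n ] 𝟙 (R? i j)  ≡⟨ ∑-comm (λ i j → 𝟙 (R? i j)) ⟩
    ∑[ j < n ] ∑[ i < m ] 𝟙 (R? i j)  ≤⟨ ∑-mono-≤ (λ j → ∑𝟙-≤-𝟙 (λ i → R? i j) (Q? j) unique R⇒Q) ⟩
    ∑[ j < n ] 𝟙 (Q? j)               ≡⟨ sym (count≡∑𝟙 Q?) ⟩
    count Q?                          ∎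
    where open ≤-Reasoning

  count-≤-∑∑𝟙 : {Q : Pred (Fin n) 0ℓ} (Q? : Decidable Q)
                → (∀ {j} → Q j → ∃ λ i → R i j)
                → count Q? ≤ ∑[ i < m ] ∑[ j < n ] 𝟙 (R? i j)
  count-≤-∑∑𝟙 Q? Q⇒∃R = begin
    count Q?                          ≡⟨ count≡∑𝟙 Q? ⟩
    ∑[ j < n ] 𝟙 (Q? j)               ≤⟨ ∑-mono-≤ (λ j → 𝟙-≤-∑𝟙 (λ i → R? i j) (Q? j) Q⇒∃R) ⟩
    ∑[ j < n ] ∑[ i < m ] 𝟙 (R? i j)  ≡⟨ ∑-comm (λ j i → 𝟙 (R? i j)) ⟩
    ∑[ i < m ] ∑[ j < n ] 𝟙 (R? i j)  ∎
    where open ≤-Reasoning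

module _ {m n : ℕ} {P : Pred (Fin m) 0ℓ} {Q : Pred (Fin n) 0ℓ}
         (P? : Decidable P) (Q? : Decidable Q) (h : Fin m → Fin n) where

  private
    count≡∑∑𝟙-graph : count P? ≡ ∑[ i < m ] ∑[ j < n ] 𝟙 (P? i ×-dec (h i ≟ j))
    count≡∑∑𝟙-graph = trans (count≡∑𝟙 P?) (sum-cong-≗ (λ i → sym (∑𝟙-graph (P? i) (h i))))

  count-≤-injection : Injective _≡_ _≡_ h → (∀ {i} → P i → Q (h i)) → count P? ≤ count Q?
  count-≤-injection h-inj P⇒Q = begin
    count P?                                         ≡⟨ count≡∑∑𝟙-graph ⟩
    ∑[ i < m ] ∑[ j < n ] 𝟙 (P? i ×-dec (h i ≟ j))   ≤⟨ ∑∑𝟙-≤-count (λ i j → P? i ×-dec (h i ≟ j)) Q?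
                                                          (λ (_ , hi≡j) (_ , hi′≡j) → h-inj (trans hi≡j (sym hi′≡j)))
                                                          (λ { (p , refl) → P⇒Q p }) ⟩
    count Q?                                         ∎
    where open ≤-Reasoning

  count-≤-surjection : (∀ {j} → Q j → ∃ λ i → P i × h i ≡ j) → count Q? ≤ count P?
  count-≤-surjection Q⇒∃P = begin
    count Q?                                         ≤⟨ count-≤-∑∑𝟙 (λ i j → P? i ×-dec (h i ≟ j)) Q? Q⇒∃P ⟩
    ∑[ i < m ] ∑[ j < n ] 𝟙 (P? i ×-dec (h i ≟ j))   ≡⟨ sym count≡∑∑𝟙-graph ⟩
    count P?                                         ∎
    where open ≤-Reasoning

𝟙-×-dec-split : ∀ {p} {P : Set p} (P? : Dec P) (b : Bool)
                → 𝟙 (P? ×-dec yes tt) ≡ 𝟙 (P? ×-dec (b ≟ᴮ true)) + 𝟙 (P? ×-dec (b ≟ᴮ false))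
𝟙-×-dec-split (yes _) true  = refl
𝟙-×-dec-split (yes _) false = refl
𝟙-×-dec-split (no _)  _     = refl

count-split : ∀ {n} {P Q R : Pred (Fin n) 0ℓ} (P? : Decidable P) (Q? : Decidable Q) (R? : Decidable R)
              → (∀ i → 𝟙 (P? i) ≡ 𝟙 (Q? i) + 𝟙 (R? i)) → count P? ≡ count Q? + count R?
count-split {n} P? Q? R? split = begin
  count P?                                   ≡⟨ count≡∑𝟙 P? ⟩
  ∑[ i < n ] 𝟙 (P? i)                        ≡⟨ sum-cong-≗ split ⟩
  ∑[ i < n ] (𝟙 (Q? i) + 𝟙 (R? i))           ≡⟨ ∑-distrib-+ (λ i → 𝟙 (Q? i)) (λ i → 𝟙 (R? i)) ⟩
  ∑[ i < n ] 𝟙 (Q? i) + ∑[ i < n ] 𝟙 (R? i)  ≡⟨ cong₂ _+_ (count≡∑𝟙 Q?) (count≡∑𝟙 R?) ⟨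
  count Q? + count R?                        ∎
  where open ≡-Reasoning

module _ {A : Set} (f : A → A) where

  iter-+ : ∀ i j x → iter f (i + j) x ≡ iter f i (iter f j x)
  iter-+ zero    j x = refl
  iter-+ (suc i) j x = cong f (iter-+ i j x)

  iter-*-periodic : ∀ {p x} → iter f p x ≡ x → ∀ q → iter f (q * p) x ≡ x
  iter-*-periodic             fᵖx≡x zero    = refl
  iter-*-periodic {p} {x} fᵖx≡x (suc q) =
    trans (iter-+ p (q * p) x) (trans (cong (iter f p) (iter-*-periodic fᵖx≡x q)) fᵖx≡x)

  iter-injective : Injective _≡_ _≡_ f → ∀ j → Injective _≡_ _≡_ (iter f j)
  iter-injective f-inj zero    eq = eq
  iter-injective f-inj (suc j) eq = iter-injective f-inj j (f-inj eq)

  iter-preserves : ∀ {ℓ} {P : Pred A ℓ} → (∀ {x} → P x → P (f x)) → ∀ j {x} → P x → P (iter f j x)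
  iter-preserves f-pres zero    px = px
  iter-preserves {P = P} f-pres (suc j) px = f-pres (iter-preserves {P = P} f-pres j px)

∑-rep-*𝟙 : ∀ {n} (f : Fin n → Fin n) {Q : Pred (Fin n) 0ℓ} (Q? : Decidable Q) d
           → ∑[ r < n ] (𝟙 (isRep? f r ×-dec yes tt) * (d * 𝟙 (Q? r))) ≡ d * countOrbits f Q?
∑-rep-*𝟙 {n} f Q? d = begin
  ∑[ r < n ] (𝟙 (isRep? f r ×-dec yes tt) * (d * 𝟙 (Q? r)))  ≡⟨ sum-cong-≗ (λ r → pointwise (isRep? f r) (Q? r)) ⟩
  ∑[ r < n ] (d * 𝟙 (isRep? f r ×-dec Q? r))                 ≡⟨ *-distribˡ-sum d (λ r → 𝟙 (isRep? f r ×-dec Q? r)) ⟨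
  d * ∑[ r < n ] 𝟙 (isRep? f r ×-dec Q? r)                   ≡⟨ cong (d *_) (count≡∑𝟙 (λ r → isRep? f r ×-dec Q? r)) ⟨
  d * countOrbits f Q?                                       ∎
  where
  open ≡-Reasoning
  pointwise : ∀ {a b} {A : Set a} {B : Set b} (A? : Dec A) (B? : Dec B)
              → 𝟙 (A? ×-dec yes tt) * (d * 𝟙 B?) ≡ d * 𝟙 (A? ×-dec B?)
  pointwise (yes _) B? = +-identityʳ (d * 𝟙 B?)
  pointwise (no _)  B? = sym (*-zeroʳ d)

module Orbits {n : ℕ} (f : Fin n → Fin n) (f-injective : Injective _≡_ _≡_ f) where

  iter-≡⇒periodic : ∀ {i j x} → i < j → iter f i x ≡ iter f j x → iter f (j ∸ i) x ≡ x
  iter-≡⇒periodic {i} {j} {x} i<j fⁱx≡fʲx = sym (iter-injective f f-injective i (begin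
    iter f i x                ≡⟨ fⁱx≡fʲx ⟩
    iter f j x                ≡⟨ cong (λ k → iter f k x) (m+[n∸m]≡n (<⇒≤ i<j)) ⟨
    iter f (i + (j ∸ i)) x    ≡⟨ iter-+ f i (j ∸ i) x ⟩
    iter f i (iter f (j ∸ i) x) ∎))
    where open ≡-Reasoning

  ∃-period : ∀ x → ∃ λ p → 0 < p × p ≤ n × iter f p x ≡ x
  ∃-period x with i , j , i<j , fⁱx≡fʲx ← pigeonhole (n<1+n n) (λ i → iter f (toℕ i) x) =
    toℕ j ∸ toℕ i , m<n⇒0<n∸m i<j , ≤-trans (m∸n≤m (toℕ j) (toℕ i)) (≤-pred (toℕ<n j)) ,
    iter-≡⇒periodic i<j fⁱx≡fʲx

  iter-%-period : ∀ {p x} .{{_ : NonZero p}} → iter f p x ≡ x → ∀ j → iter f (j % p) x ≡ iter f j x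
  iter-%-period {p} {x} fᵖx≡x j = begin
    iter f (j % p) x                          ≡⟨ cong (iter f (j % p)) (iter-*-periodic f fᵖx≡x (j / p)) ⟨
    iter f (j % p) (iter f (j / p * p) x)     ≡⟨ iter-+ f (j % p) (j / p * p) x ⟨
    iter f (j % p + j / p * p) x              ≡⟨ cong (λ k → iter f k x) (m≡m%n+[m/n]*n j p) ⟨
    iter f j x                                ∎
    where open ≡-Reasoning

  iter∈orbit : ∀ j x → InOrbit f x (iter f j x)
  iter∈orbit j x with p , 0<p , p≤n , fᵖx≡x ← ∃-period x =
    fromℕ< j%p<n , trans (cong (λ k → iter f k x) (toℕ-fromℕ< j%p<n)) (iter-%-period fᵖx≡x j)
    where
    instance _ = >-nonZero 0<p
    j%p<n = ≤-trans (m%n<n j p) p≤n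

  InOrbit-trans : ∀ {x y z} → InOrbit f x y → InOrbit f y z → InOrbit f x z
  InOrbit-trans {x} (i , refl) (j , refl) =
    subst (InOrbit f x) (iter-+ f (toℕ j) (toℕ i) x) (iter∈orbit (toℕ j + toℕ i) x)

  InOrbit-sym : ∀ {x y} → InOrbit f x y → InOrbit f y x
  InOrbit-sym {x} (i , refl) with p , 0<p , _ , fᵖx≡x ← ∃-period x =
    subst (InOrbit f (iter f (toℕ i) x)) back (iter∈orbit (p ∸ r) _)
    where
    instance _ = >-nonZero 0<p
    r = toℕ i % p
    back : iter f (p ∸ r) (iter f (toℕ i) x) ≡ x
    back = begin
      iter f (p ∸ r) (iter f (toℕ i) x)  ≡⟨ cong (iter f (p ∸ r)) (iter-%-period fᵖx≡x (toℕ i)) ⟨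
      iter f (p ∸ r) (iter f r x)        ≡⟨ iter-+ f (p ∸ r) r x ⟨
      iter f (p ∸ r + r) x               ≡⟨ cong (λ k → iter f k x) (m∸n+n≡m (<⇒≤ (m%n<n (toℕ i) p))) ⟩
      iter f p x                         ≡⟨ fᵖx≡x ⟩
      x                                  ∎
      where open ≡-Reasoning

  IsRep-unique : ∀ {r r′ x} → IsRep f r → IsRep f r′ → InOrbit f r x → InOrbit f r′ x → r ≡ r′
  IsRep-unique rep rep′ r∼x r′∼x = toℕ-injective (≤-antisym
    (IsRep-≤ rep (InOrbit-trans r∼x (InOrbit-sym r′∼x)))
    (IsRep-≤ rep′ (InOrbit-trans r′∼x (InOrbit-sym r∼x))))
    where
    IsRep-≤ : ∀ {r x} → IsRep f r → InOrbit f r x → toℕ r ≤ toℕ x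
    IsRep-≤ rep (j , refl) = rep j

  orbitSize-≥ : ∀ {s x} → (∀ j → 0 < j → j < s → iter f j x ≢ x) → s ≤ orbitSize f x
  orbitSize-≥ {s} {x} aperiodic = begin
    s                          ≡⟨ count-all s ⟨
    count {s} (λ _ → yes tt)   ≤⟨ count-≤-injection (λ _ → yes tt) (inOrbit? f x) (λ j → iter f (toℕ j) x)
                                    injective (λ {j} _ → iter∈orbit (toℕ j) x) ⟩
    orbitSize f x              ∎
    where
    open ≤-Reasoning
    injective : Injective _≡_ _≡_ (λ (j : Fin s) → iter f (toℕ j) x)
    injective {i} {j} eq with <-cmp (toℕ i) (toℕ j)
    ... | tri≈ _ i≡j _ = toℕ-injective i≡j
    ... | tri< i<j _ _ = contradiction (iter-≡⇒periodic i<j eq)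
                           (aperiodic _ (m<n⇒0<n∸m i<j) (≤-<-trans (m∸n≤m (toℕ j) (toℕ i)) (toℕ<n j)))
    ... | tri> _ _ j<i = contradiction (iter-≡⇒periodic j<i (sym eq))
                           (aperiodic _ (m<n⇒0<n∸m j<i) (≤-<-trans (m∸n≤m (toℕ i) (toℕ j)) (toℕ<n i)))

  orbitSize-≤ : ∀ {p x} .{{_ : NonZero p}} → iter f p x ≡ x → orbitSize f x ≤ p
  orbitSize-≤ {p} {x} fᵖx≡x = begin
    orbitSize f x              ≤⟨ count-≤-surjection (λ _ → yes tt) (inOrbit? f x) (λ j → iter f (toℕ j) x) preimage ⟩
    count {p} (λ _ → yes tt)   ≡⟨ count-all p ⟩
    p                          ∎
    where
    open ≤-Reasoning
    preimage : ∀ {y} → InOrbit f x y → ∃ λ (j : Fin p) → ⊤ × iter f (toℕ j) x ≡ y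
    preimage (j , refl) = fromℕ< (m%n<n (toℕ j) p) , tt ,
      trans (cong (λ k → iter f k x) (toℕ-fromℕ< (m%n<n (toℕ j) p))) (iter-%-period fᵖx≡x (toℕ j))

  module _ {P : Pred (Fin n) 0ℓ} (P? : Decidable P) (f-preserves : ∀ {x} → P x → P (f x)) where

    ∑-orbitSize-≤-count : ∑[ r < n ] (𝟙 (isRep? f r ×-dec P? r) * orbitSize f r) ≤ count P?
    ∑-orbitSize-≤-count = begin
      ∑[ r < n ] (𝟙 (R? r) * orbitSize f r)                ≡⟨ sum-cong-≗ (λ r → ∑𝟙-×-dec (R? r) (inOrbit? f r)) ⟨
      ∑[ r < n ] ∑[ x < n ] 𝟙 (R? r ×-dec inOrbit? f r x)  ≤⟨ ∑∑𝟙-≤-count (λ r x → R? r ×-dec inOrbit? f r x) P?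
          (λ ((rep , _) , r∼x) ((rep′ , _) , r′∼x) → IsRep-unique rep rep′ r∼x r′∼x)
          (λ { ((_ , pr) , (j , refl)) → iter-preserves f {P = P} f-preserves (toℕ j) pr }) ⟩
      count P?                                             ∎
      where
      open ≤-Reasoning
      R? = λ r → isRep? f r ×-dec P? r

    countOrbits-*-≤ : ∀ c (w : Fin n → ℕ) → (∀ {r} → P r → c ≤ orbitSize f r + w r)
                      → c * countOrbits f P? ≤ count P? + ∑[ r < n ] (𝟙 (isRep? f r ×-dec P? r) * w r)
    countOrbits-*-≤ c w bound = begin
      c * countOrbits f P?                                     ≡⟨ cong (c *_) (count≡∑𝟙 R?) ⟩
      c * ∑[ r < n ] 𝟙 (R? r)                                  ≡⟨ *-distribˡ-sum c (λ r → 𝟙 (R? r)) ⟩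
      ∑[ r < n ] (c * 𝟙 (R? r))                                ≤⟨ ∑-mono-≤ (λ r → *-𝟙-≤ (R? r) (λ (_ , pr) → bound pr)) ⟩
      ∑[ r < n ] (𝟙 (R? r) * (orbitSize f r + w r))            ≡⟨ sum-cong-≗ (λ r → *-distribˡ-+ (𝟙 (R? r)) _ _) ⟩
      ∑[ r < n ] (𝟙 (R? r) * orbitSize f r + 𝟙 (R? r) * w r)   ≡⟨ ∑-distrib-+ (λ r → 𝟙 (R? r) * orbitSize f r) _ ⟩
      ∑[ r < n ] (𝟙 (R? r) * orbitSize f r) + ∑[ r < n ] (𝟙 (R? r) * w r)
                                                               ≤⟨ +-monoˡ-≤ _ ∑-orbitSize-≤-count ⟩
      count P? + ∑[ r < n ] (𝟙 (R? r) * w r)                   ∎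
      where
      open ≤-Reasoning
      R? = λ r → isRep? f r ×-dec P? r

    countOrbits-*-≤-count : ∀ c → (∀ {r} → P r → c ≤ orbitSize f r) → c * countOrbits f P? ≤ count P?
    countOrbits-*-≤-count c bound = begin
      c * countOrbits f P?                          ≤⟨ countOrbits-*-≤ c (λ _ → 0) (λ pr → ≤-trans (bound pr) (m≤m+n _ 0)) ⟩
      count P? + ∑[ r < n ] (𝟙 (R? r) * 0)          ≡⟨ cong (count P? +_) (sum-cong-≗ (λ r → *-zeroʳ (𝟙 (R? r)))) ⟩
      count P? + ∑[ r < n ] 0                       ≡⟨ cong (count P? +_) (sum-replicate-zero n) ⟩
      count P? + 0                                  ≡⟨ +-identityʳ _ ⟩
      count P?                                      ∎
      where
      open ≤-Reasoning
      R? = λ r → isRep? f r ×-dec P? r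

  module Alternating (c : Fin n → Bool) (c-alternates : ∀ x → c (f x) ≢ c x) where

    c∘f²≡c : ∀ x → c (f (f x)) ≡ c x
    c∘f²≡c x = begin
      c (f (f x))      ≡⟨ ¬-not (c-alternates (f x)) ⟩
      not (c (f x))    ≡⟨ cong not (¬-not (c-alternates x)) ⟩
      not (not (c x))  ≡⟨ not-involutive (c x) ⟩
      c x              ∎
      where open ≡-Reasoning

    f-moves : ∀ x → f x ≢ x
    f-moves x fx≡x = c-alternates x (cong c fx≡x)

    f³-moves : ∀ x → f (f (f x)) ≢ x
    f³-moves x f³x≡x = c-alternates x (trans (sym (c∘f²≡c (f x))) (cong c f³x≡x))

    2≤orbitSize : ∀ x → 2 ≤ orbitSize f x
    2≤orbitSize x = orbitSize-≥ λ { 1 _ _ → f-moves x ; (suc (suc _)) _ (s≤s (s≤s ())) }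

    orbitSize≢2⇒4≤ : ∀ x → orbitSize f x ≢ 2 → 4 ≤ orbitSize f x
    orbitSize≢2⇒4≤ x size≢2 with f (f x) ≟ x
    ... | yes f²x≡x = contradiction (≤-antisym (orbitSize-≤ {2} f²x≡x) (2≤orbitSize x)) size≢2
    ... | no  f²x≢x = orbitSize-≥ λ where
      1 _ _ → f-moves x
      2 _ _ → f²x≢x
      3 _ _ → f³-moves x
      (suc (suc (suc (suc _)))) _ (s≤s (s≤s (s≤s (s≤s ()))))

small-face-deficit : ∀ t {s} → 2 ≤ s → (small? : Dec (suc s ≤ 2 * (2 + t)))
                     → 2 * (2 + t) ≤ s + 2 * (1 + t) * 𝟙 small?
small-face-deficit t {s} 2≤s (yes _)     = subst (_≤ s + 2 * (1 + t) * 1) (sym (2k≡2+2[k-1] t)) (+-monoˡ-≤ _ 2≤s)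
  where
  2k≡2+2[k-1] : ∀ t → 2 * (2 + t) ≡ 2 + 2 * (1 + t) * 1
  2k≡2+2[k-1] = solve-∀
small-face-deficit t {s} 2≤s (no  large) = ≤-trans (≤-pred (≰⇒> large)) (m≤m+n s _)

small-face-deficit′ : ∀ t {s} → (s ≢ 2 → 4 ≤ s) → (small? : Dec (suc s ≤ 2 * (2 + t))) (digon? : Dec (s ≡ 2))
                      → 2 * (2 + t) ≤ s + (2 * t * 𝟙 small? + 2 * 𝟙 digon?)
small-face-deficit′ t     4≤s (yes _) (yes refl) = ≤-reflexive (2k≡2+[2[k-2]+2] t)
  where
  2k≡2+[2[k-2]+2] : ∀ t → 2 * (2 + t) ≡ 2 + (2 * t * 1 + 2 * 1)
  2k≡2+[2[k-2]+2] = solve-∀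
small-face-deficit′ t {s} 4≤s (yes _) (no s≢2)   =
  subst (_≤ s + (2 * t * 1 + 2 * 0)) (sym (2k≡4+2[k-2] t)) (+-monoˡ-≤ _ (4≤s s≢2))
  where
  2k≡4+2[k-2] : ∀ t → 2 * (2 + t) ≡ 4 + (2 * t * 1 + 2 * 0)
  2k≡4+2[k-2] = solve-∀
small-face-deficit′ t {s} 4≤s (no large) _       = ≤-trans (≤-pred (≰⇒> large)) (m≤m+n s _)

module _ {m : ℕ} (G : EmbeddedGraph m) (B : Bipartition G) where

  open EmbeddedGraph G
  open Bipartition B

  private
    α-injective : ∀ {d d′} → α d ≡ α d′ → d ≡ d′
    α-injective {d} {d′} eq = trans (sym (α-invol d)) (trans (cong α eq) (α-invol d′))

    σ-injective : ∀ {d d′} → σ d ≡ σ d′ → d ≡ d′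
    σ-injective {d} {d′} eq = trans (sym (σ⁻¹σ d)) (trans (cong σ⁻¹ eq) (σ⁻¹σ d′))

    col-φ-alternates : ∀ d → col (φ d) ≢ col d
    col-φ-alternates d eq = col-edge d (trans (sym (col-vert (α d))) eq)

    module Vertices = Orbits σ σ-injective
    module Faces = Orbits φ (α-injective ∘ σ-injective)
    open Faces.Alternating col col-φ-alternates using (2≤orbitSize; orbitSize≢2⇒4≤)

  numVertices≡sizeV₁+sizeV₂ : numVertices ≡ sizeV₁ + sizeV₂
  numVertices≡sizeV₁+sizeV₂ = count-split _ _ _ (λ d → 𝟙-×-dec-split (isRep? σ d) (col d))

  2*sizeV₂≤numEdges : (∀ d → col d ≡ false → 2 ≤ degree d) → 2 * sizeV₂ ≤ numEdges
  2*sizeV₂≤numEdges 2≤degree = ≤-trans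
    (Vertices.countOrbits-*-≤-count (λ d → col d ≟ᴮ false) (λ {d} → trans (col-vert d)) 2 (2≤degree _))
    #V₂-darts≤m
    where
    #V₁-darts = count (λ d → col d ≟ᴮ true)
    #V₂-darts = count (λ d → col d ≟ᴮ false)

    #V₂-darts≤#V₁-darts : #V₂-darts ≤ #V₁-darts
    #V₂-darts≤#V₁-darts = count-≤-injection _ _ α α-injective
      (λ {d} col[d]≡false → trans (¬-not (col-edge d)) (cong not col[d]≡false))

    #V₂-darts≤m : #V₂-darts ≤ m
    #V₂-darts≤m = *-cancelˡ-≤ 2 (begin
      2 * #V₂-darts            ≡⟨ cong (#V₂-darts +_) (+-identityʳ #V₂-darts) ⟩
      #V₂-darts + #V₂-darts    ≤⟨ +-monoˡ-≤ #V₂-darts #V₂-darts≤#V₁-darts ⟩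
      #V₁-darts + #V₂-darts    ≡⟨ count-split trivial? _ _ (λ d → 𝟙-×-dec-split (yes tt) (col d)) ⟨
      count trivial?           ≡⟨ count-all (2 * m) ⟩
      2 * m                    ∎)
      where open ≤-Reasoning

  faces-bound : ∀ t → (2 + t) * numFaces ≤ m + facesSmallerThan (2 * (2 + t)) * (1 + t)
  faces-bound t = *-cancelˡ-≤ 2 (begin
    2 * ((2 + t) * numFaces)                                     ≡⟨ *-assoc 2 (2 + t) numFaces ⟨
    2 * (2 + t) * numFaces                                       ≤⟨ Faces.countOrbits-*-≤ trivial? (λ _ → tt) (2 * (2 + t)) w
                                                                      (λ {r} _ → small-face-deficit t (2≤orbitSize r) (small? r)) ⟩
    count trivial? + ∑[ r < 2 * m ] (𝟙 (isRep? φ r ×-dec trivial? r) * w r)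
                                                                 ≡⟨ cong₂ _+_ (count-all (2 * m)) (∑-rep-*𝟙 φ small? (2 * (1 + t))) ⟩
    2 * m + 2 * (1 + t) * #small                                 ≡⟨ rearrange m t #small ⟩
    2 * (m + #small * (1 + t))                                   ∎)
    where
    open ≤-Reasoning
    small? = λ r → suc (orbitSize φ r) ≤? 2 * (2 + t)
    w = λ r → 2 * (1 + t) * 𝟙 (small? r)
    #small = facesSmallerThan (2 * (2 + t))
    rearrange : ∀ m t i → 2 * m + 2 * (1 + t) * i ≡ 2 * (m + i * (1 + t))
    rearrange = solve-∀

  faces-bound′ : ∀ t → facesOfSize 2 ≤ 1 → (2 + t) * numFaces ≤ m + (1 + facesSmallerThan (2 * (2 + t)) * t)
  faces-bound′ t #digons≤1 = *-cancelˡ-≤ 2 (begin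
    2 * ((2 + t) * numFaces)                                     ≡⟨ *-assoc 2 (2 + t) numFaces ⟨
    2 * (2 + t) * numFaces                                       ≤⟨ Faces.countOrbits-*-≤ trivial? (λ _ → tt) (2 * (2 + t)) w
                                                                      (λ {r} _ → small-face-deficit′ t (orbitSize≢2⇒4≤ r) (small? r) (digon? r)) ⟩
    count trivial? + ∑[ r < 2 * m ] (𝟙 (R? r) * w r)            ≡⟨ cong₂ _+_ (count-all (2 * m)) ∑-weights ⟩
    2 * m + (2 * t * #small + 2 * facesOfSize 2)                 ≤⟨ +-monoʳ-≤ (2 * m) (+-monoʳ-≤ (2 * t * #small) (*-monoʳ-≤ 2 #digons≤1)) ⟩
    2 * m + (2 * t * #small + 2 * 1)                             ≡⟨ rearrange m t #small ⟩
    2 * (m + (1 + #small * t))                                   ∎)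
    where
    open ≤-Reasoning
    R? = λ r → isRep? φ r ×-dec trivial? r
    small? = λ r → suc (orbitSize φ r) ≤? 2 * (2 + t)
    digon? = λ r → orbitSize φ r ℕ.≟ 2
    w = λ r → 2 * t * 𝟙 (small? r) + 2 * 𝟙 (digon? r)
    #small = facesSmallerThan (2 * (2 + t))
    ∑-weights : ∑[ r < 2 * m ] (𝟙 (R? r) * w r) ≡ 2 * t * #small + 2 * facesOfSize 2
    ∑-weights = begin-equality
      ∑[ r < 2 * m ] (𝟙 (R? r) * w r)                            ≡⟨ sum-cong-≗ (λ r → *-distribˡ-+ (𝟙 (R? r)) _ _) ⟩
      ∑[ r < 2 * m ] (𝟙 (R? r) * (2 * t * 𝟙 (small? r)) + 𝟙 (R? r) * (2 * 𝟙 (digon? r)))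
                                                                 ≡⟨ ∑-distrib-+ (λ r → 𝟙 (R? r) * (2 * t * 𝟙 (small? r))) _ ⟩
      ∑[ r < 2 * m ] (𝟙 (R? r) * (2 * t * 𝟙 (small? r))) + ∑[ r < 2 * m ] (𝟙 (R? r) * (2 * 𝟙 (digon? r)))
                                                                 ≡⟨ cong₂ _+_ (∑-rep-*𝟙 φ small? (2 * t)) (∑-rep-*𝟙 φ digon? 2) ⟩
      2 * t * #small + 2 * facesOfSize 2                         ∎
    rearrange : ∀ m t i → 2 * m + (2 * t * i + 2 * 1) ≡ 2 * (m + (1 + i * t))
    rearrange = solve-∀

euler-bound : ∀ t {m v f g} d → 1 + v + f + 2 * g ≡ 2 + m → 2 * v ≤ m → (2 + t) * f ≤ m + d
              → (2 + t) + t * v ≤ d + 2 * (2 + t) * g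
euler-bound t {m} {v} {f} {g} d euler 2v≤m faces = +-cancelˡ-≤ x _ _ (begin
  x + ((2 + t) + t * v)                ≡⟨ ring₁ t m v ⟩
  m + 2 * (2 + t) + (1 + t) * (2 * v)  ≤⟨ +-monoʳ-≤ (m + 2 * (2 + t)) (*-monoʳ-≤ (1 + t) 2v≤m) ⟩
  m + 2 * (2 + t) + (1 + t) * m        ≡⟨ ring₂ t m ⟩
  (2 + t) * (2 + m)                    ≡⟨ cong ((2 + t) *_) euler ⟨
  (2 + t) * (1 + v + f + 2 * g)        ≡⟨ ring₃ t v f g ⟩
  (2 + t) * f + (2 + t) * (1 + v + 2 * g)
                                       ≤⟨ +-monoˡ-≤ _ faces ⟩
  m + d + (2 + t) * (1 + v + 2 * g)    ≡⟨ ring₄ t m v g d ⟩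
  x + (d + 2 * (2 + t) * g)            ∎)
  where
  open ≤-Reasoning
  x = m + (2 + t) + 2 * v + t * v
  ring₁ : ∀ t m v → m + (2 + t) + 2 * v + t * v + ((2 + t) + t * v) ≡ m + 2 * (2 + t) + (1 + t) * (2 * v)
  ring₁ = solve-∀
  ring₂ : ∀ t m → m + 2 * (2 + t) + (1 + t) * m ≡ (2 + t) * (2 + m)
  ring₂ = solve-∀
  ring₃ : ∀ t v f g → (2 + t) * (1 + v + f + 2 * g) ≡ (2 + t) * f + (2 + t) * (1 + v + 2 * g)
  ring₃ = solve-∀
  ring₄ : ∀ t m v g d → m + d + (2 + t) * (1 + v + 2 * g) ≡ m + (2 + t) + 2 * v + t * v + (d + 2 * (2 + t) * g)
  ring₄ = solve-∀

lemma7 : (m : ℕ) (G : EmbeddedGraph m) (B : Bipartition G) (g k : ℕ)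
         → EmbeddedGraph.HasGenus G g
         → Bipartition.sizeV₁ B ≡ 1
         → (∀ d → Bipartition.col B d ≡ false → 2 ≤ EmbeddedGraph.degree G d)
         → 2 ≤ k
         → (k + (k ∸ 2) * Bipartition.sizeV₂ B
              ≤ EmbeddedGraph.facesSmallerThan G (2 * k) * (k ∸ 1) + 2 * k * g)
           × (3 ≤ k → EmbeddedGraph.facesOfSize G 2 ≤ 1
              → (k ∸ 1) + (k ∸ 2) * Bipartition.sizeV₂ B
                   ≤ EmbeddedGraph.facesSmallerThan G (2 * k) * (k ∸ 2) + 2 * k * g)
lemma7 m G B g 1 _ _ _ (s≤s ())
lemma7 m G B g (suc (suc t)) genus |V₁|≡1 2≤degree _ =
  euler-bound t {g = g} _ euler 2|V₂|≤m (faces-bound G B t) ,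
  λ _ #digons≤1 → ≤-pred (euler-bound t {g = g} _ euler 2|V₂|≤m (faces-bound′ G B t #digons≤1))
  where
  open EmbeddedGraph G
  open Bipartition B
  euler : 1 + sizeV₂ + numFaces + 2 * g ≡ 2 + m
  euler = subst (λ v → v + numFaces + 2 * g ≡ 2 + m)
                (trans (numVertices≡sizeV₁+sizeV₂ G B) (cong (_+ sizeV₂) |V₁|≡1)) genus
  2|V₂|≤m : 2 * sizeV₂ ≤ m
  2|V₂|≤m = 2*sizeV₂≤numEdges G B 2≤degree
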